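{- Let $(\mathfrak Q,\cdot)$ be a quasigroup and $\mathcal N=\mathcal N(\mathfrak Q)$ its $3$-net, with corresponding biased expansion graph $\Omega(\mathcal N)=\langle\mathfrak QK_3\rangle$. The $3$-subnets of $\mathcal N$ have the form $\mathcal N(\mathfrak Q_1)$ where $\mathfrak Q_1$ is a subquasigroup of an isotope of $\mathfrak Q$, and they correspond to the biased expansions of $K_3$ that are subgraphs of $\Omega(\mathcal N)$. These subgraphs are exactly the balance-closed subgraphs of $\Omega(\mathcal N)$ that are spanning and connected, and they are also exactly the quasigroup expansions of the form $\langle\mathfrak Q_1K_3\rangle$.
   Context: A $3$-net is an incidence structure whose lines are partitioned into pencils $\mathcal L_{12},\mathcal L_{23},\mathcal L_{13}$, lines in one pencil pairwise without common point, lines in different pencils with exactly one common point, each point on exactly one line of each pencil. $\mathcal N(\mathfrak Q)$ has lines $L_{ij}(g)$ ($g\in\mathfrak Q$), $\mathcal L_{ij}=\{L_{ij}(g)\}$, and $L_{12}(g),L_{23}(h),L_{13}(k)$ share a point (one point per such triple) iff $g\cdot h=k$. A $3$-subnet of $\mathcal N$ is a $3$-net whose points and lines are points and lines of $\mathcal N$ (with induced incidence and pencils). A biased graph is a graph with a class $\mathcal B$ of circles (balanced) such that no theta subgraph contains exactly two balanced circles; a subgraph $\Omega_1$ of $\Omega$ has $\|\Omega_1\|\subseteq\|\Omega\|$ and balanced circles those of $\Omega$ lying in $\Omega_1$; it is spanning if it contains all nodes. The balance-closure of an edge set $S$ is $S\cup\{e\notin S:$ some balanced circle $C$ has $e\in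 C\subseteq S\cup\{e\}\}$, and $S$ (or the subgraph) is balance-closed if it equals its balance-closure. $K_3$ has nodes $v_1,v_2,v_3$, edges $e_{12},e_{23},e_{13}$. A biased expansion of $K_3$ is a biased graph with no half edges and no balanced digons, with a surjective graph map $p$ to $K_3$ that is the identity on nodes, such that for every edge $e_{ij}$ of $K_3$ and every choice of edges over the two other edges there is a unique edge over $e_{ij}$ completing a balanced triangle. The quasigroup expansion $\langle\mathfrak QK_3\rangle$ has nodes $v_1,v_2,v_3$, links $ge_{ij}$ joining $v_i,v_j$, and balanced circles exactly the triangles $\{ge_{12},he_{23},ke_{13}\}$ with $g\cdot h=k$. $\Omega(\mathcal N)$ is the biased graph whose edges are the lines of $\mathcal N$ (a line of $\mathcal L_{ij}$ joins $v_i,v_j$) with a triangle balanced iff its three lines share a point; $\Omega(\mathcal N(\mathfrak Q))$ is identified with $\langle\mathfrak QK_3\rangle$ via $L_{ij}(g)\leftrightarrow ge_{ij}$. Quasigroups $(Q,\cdot),(Q',\times)$ are isotopic if there are bijections $\alpha,\beta,\gamma$ with $\alpha(x)\times\beta(y)=\gamma(x\cdot y)$. -}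

module Defs where

open import Level using (0ℓ)
open import Data.Product using (Σ; Σ-syntax; ∃!; _×_; _,_; proj₁; proj₂)
open import Relation.Binary.PropositionalEquality using (_≡_; _≢_)
open import Relation.Nullary using (¬_)
import Data.Empty
import Data.Sum
open import Function.Bundles using (_⇔_)
open import Function.Definitions using (Bijective)

record IsQuasigroup (Q : Set) (_∙_ : Q → Q → Q) : Set where
  field
    leftSolve  : ∀ a b → ∃! _≡_ (λ x → a ∙ x ≡ b)
    rightSolve : ∀ a b → ∃! _≡_ (λ y → y ∙ a ≡ b)

record IsIsotopy {Q Q' : Set} (_·_ : Q → Q → Q) (_⊗_ : Q' → Q' → Q')
                 (α β γ : Q → Q') : Set where
  field
    α-bij : Bijective _≡_ _≡_ α
    β-bij : Bijective _≡_ _≡_ β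
    γ-bij : Bijective _≡_ _≡_ γ
    iso   : ∀ x y → α x ⊗ β y ≡ γ (x · y)

record IsSubquasigroup {Q' : Set} (_⊗_ : Q' → Q' → Q') (Q₁ : Q' → Set) : Set where
  field
    nonempty  : Σ Q' Q₁
    mulClosed : ∀ a b → Q₁ a → Q₁ b → Q₁ (a ⊗ b)
    ldivClosed : ∀ a b x → Q₁ a → Q₁ b → a ⊗ x ≡ b → Q₁ x
    rdivClosed : ∀ a b y → Q₁ a → Q₁ b → y ⊗ a ≡ b → Q₁ y

data Node : Set where
  v1 v2 v3 : Node

-- pencil L_ij  =  edge class over e_ij
data Pencil : Set where
  p12 p23 p13 : Pencil

ends : Pencil → Node × Node
ends p12 = v1 , v2
ends p23 = v2 , v3
ends p13 = v1 , v3

module _ {Q : Set} (_·_ : Q → Q → Q) where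

  -- The 3-net N(Q).  Lines: L_π(g) for π : Pencil, g : Q.
  -- Points: one per triple (g , h , g·h); a point is determined by (g , h).

  record Point : Set where
    constructor pt
    field
      ptg ptn : Q
  open Point public

  On : Point → Pencil → Q → Set
  On p p12 g = ptg p ≡ g
  On p p23 h = ptn p ≡ h
  On p p13 k = (ptg p · ptn p) ≡ k

  record IsSubnet (P : Point → Set) (S : Pencil → Q → Set) : Set where
    field
      nonempty : Σ Point P
      samePencil : ∀ π g g' → S π g → S π g' → g ≢ g' →
                   ∀ p → P p → On p π g → On p π g' → Data.Empty.⊥
      diffPencil : ∀ π π' → π ≢ π' → ∀ g g' → S π g → S π' g' →
                   Σ Point λ p → (P p × On p π g × On p π' g') ×
                     (∀ p' → P p' → On p' π g → On p' π' g' → p ≡ p')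
      eachPoint : ∀ p → P p → ∀ π →
                  Σ Q λ g → (S π g × On p π g) ×
                    (∀ g' → S π g' → On p π g' → g ≡ g')

  -- Subgraphs of Ω(N(Q)) = ⟨Q K₃⟩: node set V, edge sets S π (edge g e_π).
  -- The balanced circles of ⟨Q K₃⟩ are exactly the triangles
  -- {g e₁₂, h e₂₃, k e₁₃} with g · h = k.

  IsSubgraph : (Node → Set) → (Pencil → Q → Set) → Set
  IsSubgraph V S = ∀ π g → S π g → V (proj₁ (ends π)) × V (proj₂ (ends π))

  Spanning : (Node → Set) → Set
  Spanning V = ∀ v → V v

  Adj : (Pencil → Q → Set) → Node → Node → Set
  Adj S u w = Σ Pencil λ π → Σ Q λ g → S π g ×
                ((ends π ≡ (u , w)) Data.Sum.⊎ (ends π ≡ (w , u)))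

  data Reach (S : Pencil → Q → Set) (u : Node) : Node → Set where
    here : Reach S u u
    step : ∀ {v w} → Reach S u v → Adj S v w → Reach S u w

  Connected : (Node → Set) → (Pencil → Q → Set) → Set
  Connected V S = ∀ u w → V u → V w → Reach S u w

  BalanceClosed : (Pencil → Q → Set) → Set
  BalanceClosed S = ∀ g h k → (g · h) ≡ k →
      (S p23 h → S p13 k → S p12 g) ×
      (S p12 g → S p13 k → S p23 h) ×
      (S p12 g → S p23 h → S p13 k)

  -- biased expansion of K₃ (the map p is forced: g e_ij ↦ e_ij; it is the
  -- identity on nodes and surjective).  Half edges and balanced digons do
  -- not occur in subgraphs of ⟨Q K₃⟩.
  record IsBiasedExpansion (V : Node → Set) (S : Pencil → Q → Set) : Set where
    field
      allNodes : Spanning V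
      surj     : ∀ π → Σ Q (S π)
      over12 : ∀ h k → S p23 h → S p13 k → ∃! _≡_ (λ g → S p12 g × (g · h) ≡ k)
      over23 : ∀ g k → S p12 g → S p13 k → ∃! _≡_ (λ h → S p23 h × (g · h) ≡ k)
      over13 : ∀ g h → S p12 g → S p23 h → ∃! _≡_ (λ k → S p13 k × (g · h) ≡ k)

  -- "of the form N(Q₁) / ⟨Q₁ K₃⟩ with Q₁ a subquasigroup of an isotope of Q":
  -- an isotope (Q' , ⊗) of Q via α β γ : Q → Q', a subquasigroup Q₁ of it,
  -- and (transporting N(Q') ≅ N(Q) along α⁻¹, β⁻¹, γ⁻¹) the lines are
  -- L₁₂(g) with α g ∈ Q₁, L₂₃(h) with β h ∈ Q₁, L₁₃(k) with γ k ∈ Q₁.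
  record IsotopeSub (Q' : Set) (S : Pencil → Q → Set) : Set₁ where
    field
      _⊗_ : Q' → Q' → Q'
      isQuasigroup : IsQuasigroup Q' _⊗_
      α β γ : Q → Q'
      isotopy : IsIsotopy _·_ _⊗_ α β γ
      Q₁ : Q' → Set
      sub : IsSubquasigroup _⊗_ Q₁
      lines12 : ∀ g → S p12 g ⇔ Q₁ (α g)
      lines23 : ∀ h → S p23 h ⇔ Q₁ (β h)
      lines13 : ∀ k → S p13 k ⇔ Q₁ (γ k)

  QuasigroupExpansionForm : (Pencil → Q → Set) → Set₁
  QuasigroupExpansionForm S = Σ Set λ Q' → IsotopeSub Q' S

  -- the subnet (P , S) is N(Q₁): lines as above, and points exactly the
  -- points (x , y) of N(Q₁), i.e. points L₁₂(g) ∩ L₂₃(h) with α g , β h ∈ Q₁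
  NetForm : (Point → Set) → (Pencil → Q → Set) → Set₁
  NetForm P S = Σ Set λ Q' → Σ (IsotopeSub Q' S) λ I →
    ∀ p → P p ⇔ (IsotopeSub.Q₁ I (IsotopeSub.α I (ptg p)) ×
                 IsotopeSub.Q₁ I (IsotopeSub.β I (ptn p)))

  TrianglePoints : (Pencil → Q → Set) → Point → Set
  TrianglePoints S p = S p12 (ptg p) × S p23 (ptn p) × S p13 (ptg p · ptn p)

module Submission where

-- Everything is controlled by one notion: a line set S (lines L_π(g) with
-- S π g) is *triangle-closed* if, whenever two lines of a balanced triangle
-- {g e₁₂ , h e₂₃ , (g · h) e₁₃} lie in S, so does the third.  We show:
--   * biased expansions of K₃ inside ⟨Q K₃⟩ are exactly the spanning,
--     triangle-closed line sets with every pencil inhabited;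
--   * triangle-closed = balance-closed, and for triangle-closed S on
--     spanning node sets, connected = every pencil inhabited (a walk must
--     use edges at all three nodes, and two pencils generate the third);
--   * 3-subnets have triangle-closed, inhabited line sets whose points are
--     the points L₁₂(g) ∩ L₂₃(h) with both lines in S; conversely such a
--     line set together with its triangle points is a 3-subnet;
--   * a triangle-closed, inhabited S is ⟨Q₁ K₃⟩ for Q₁ = S₁₃, a subquasigroup
--     of the principal isotope x ⊗ y = (x / b) · (a \ y), where a , b are
--     lines of S₁₂ , S₂₃; conversely every such ⟨Q₁ K₃⟩ is closed/inhabited.

open import Defs
open import Data.Empty using (⊥-elim)
open import Data.Product using (Σ; _×_; _,_; proj₁; proj₂)
open import Data.Sum using (_⊎_; inj₁; inj₂)
import Data.Unit
open import Data.Unit using (tt)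
open import Function.Bundles using (_⇔_; mk⇔; Equivalence)
open import Function.Consequences.Propositional
  using (inverseᵇ⇒bijective; strictlyInverseˡ⇒inverseˡ; strictlyInverseʳ⇒inverseʳ)
open import Function.Definitions using (Bijective)
open import Relation.Binary.PropositionalEquality
  using (_≡_; _≢_; refl; sym; trans; cong; cong₂; subst)

inverse⇒bijective : {A B : Set} (f : A → B) (f⁻¹ : B → A) →
  (∀ y → f (f⁻¹ y) ≡ y) → (∀ x → f⁻¹ (f x) ≡ x) → Bijective _≡_ _≡_ f
inverse⇒bijective f f⁻¹ invˡ invʳ = inverseᵇ⇒bijective
  (strictlyInverseˡ⇒inverseˡ f invˡ , strictlyInverseʳ⇒inverseʳ f invʳ)

module _ {Q : Set} (_·_ : Q → Q → Q) where

  record TriangleClosed (S : Pencil → Q → Set) : Set where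
    field
      close12 : ∀ {g h k} → S p23 h → S p13 k → g · h ≡ k → S p12 g
      close23 : ∀ {g h k} → S p12 g → S p13 k → g · h ≡ k → S p23 h
      close13 : ∀ {g h} → S p12 g → S p23 h → S p13 (g · h)

  Inhabited : (Pencil → Q → Set) → Set
  Inhabited S = ∀ π → Σ Q (S π)

  balanceClosed⇔triangleClosed : ∀ S → BalanceClosed _·_ S ⇔ TriangleClosed S
  balanceClosed⇔triangleClosed S = mk⇔ to from
    where
    to : BalanceClosed _·_ S → TriangleClosed S
    to bc = record
      { close12 = λ sh sk e → proj₁ (bc _ _ _ e) sh sk
      ; close23 = λ sg sk e → proj₁ (proj₂ (bc _ _ _ e)) sg sk
      ; close13 = λ sg sh → proj₂ (proj₂ (bc _ _ _ refl)) sg sh }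
    from : TriangleClosed S → BalanceClosed _·_ S
    from C g h k e = (λ sh sk → close12 sh sk e) , (λ sg sk → close23 sg sk e) ,
                     (λ sg sh → subst (S p13) e (close13 sg sh))
      where open TriangleClosed C

  on-functional : ∀ {p} π {g g'} → On _·_ p π g → On _·_ p π g' → g ≡ g'
  on-functional p12 o o' = trans (sym o) o'
  on-functional p23 o o' = trans (sym o) o'
  on-functional p13 o o' = trans (sym o) o'

  inhabited⇒connected : ∀ {S} → Inhabited S → ∀ u w → Reach _·_ S u w
  inhabited⇒connected {S} inh = walk
    where
    forward : ∀ π → Adj _·_ S (proj₁ (ends π)) (proj₂ (ends π))
    forward π = π , proj₁ (inh π) , proj₂ (inh π) , inj₁ refl
    backward : ∀ π → Adj _·_ S (proj₂ (ends π)) (proj₁ (ends π))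
    backward π = π , proj₁ (inh π) , proj₂ (inh π) , inj₂ refl
    walk : ∀ u w → Reach _·_ S u w
    walk v1 v1 = here
    walk v2 v2 = here
    walk v3 v3 = here
    walk v1 v2 = step here (forward p12)
    walk v2 v3 = step here (forward p23)
    walk v1 v3 = step here (forward p13)
    walk v2 v1 = step here (backward p12)
    walk v3 v2 = step here (backward p23)
    walk v3 v1 = step here (backward p13)

  EdgeAt : (Pencil → Q → Set) → Node → Set
  EdgeAt S v1 = Σ Q (S p12) ⊎ Σ Q (S p13)
  EdgeAt S v2 = Σ Q (S p12) ⊎ Σ Q (S p23)
  EdgeAt S v3 = Σ Q (S p23) ⊎ Σ Q (S p13)

  adj⇒edgeAt : ∀ {S v w} → Adj _·_ S v w → EdgeAt S w
  adj⇒edgeAt (p12 , g , s , inj₁ refl) = inj₁ (g , s)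
  adj⇒edgeAt (p12 , g , s , inj₂ refl) = inj₁ (g , s)
  adj⇒edgeAt (p23 , g , s , inj₁ refl) = inj₁ (g , s)
  adj⇒edgeAt (p23 , g , s , inj₂ refl) = inj₂ (g , s)
  adj⇒edgeAt (p13 , g , s , inj₁ refl) = inj₂ (g , s)
  adj⇒edgeAt (p13 , g , s , inj₂ refl) = inj₂ (g , s)

  reach⇒edgeAt : ∀ {S u w} → u ≢ w → Reach _·_ S u w → EdgeAt S w
  reach⇒edgeAt u≢u here = ⊥-elim (u≢u refl)
  reach⇒edgeAt _ (step _ a) = adj⇒edgeAt a

  -- ⟨Q₁ K₃⟩ for a subquasigroup Q₁ of an isotope is triangle-closed:
  -- the three closure rules are the three closure laws of Q₁.
  isotopeSub⇒closed : ∀ {Q' S} → IsotopeSub _·_ Q' S → TriangleClosed S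
  isotopeSub⇒closed {S = S} I = record
    { close12 = λ {g} {h} {k} sh sk e → from (lines12 g)
        (rdivClosed (β h) (γ k) (α g) (to (lines23 h) sh) (to (lines13 k) sk)
          (trans (iso g h) (cong γ e)))
    ; close23 = λ {g} {h} {k} sg sk e → from (lines23 h)
        (ldivClosed (α g) (γ k) (β h) (to (lines12 g) sg) (to (lines13 k) sk)
          (trans (iso g h) (cong γ e)))
    ; close13 = λ {g} {h} sg sh → from (lines13 (g · h))
        (subst Q₁ (iso g h)
          (mulClosed (α g) (β h) (to (lines12 g) sg) (to (lines23 h) sh))) }
    where
    open IsotopeSub I
    open IsIsotopy isotopy
    open IsSubquasigroup sub
    open Equivalence

  -- ⟨Q₁ K₃⟩ has lines in every pencil: the preimages of an element of Q₁.
  isotopeSub⇒inhabited : ∀ {Q' S} → IsotopeSub _·_ Q' S → Inhabited S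
  isotopeSub⇒inhabited {S = S} I = λ
    { p12 → preimage α α-bij lines12
    ; p23 → preimage β β-bij lines23
    ; p13 → preimage γ γ-bij lines13 }
    where
    open IsotopeSub I
    open IsIsotopy isotopy
    q = proj₁ (IsSubquasigroup.nonempty sub)
    q∈Q₁ = proj₂ (IsSubquasigroup.nonempty sub)
    preimage : ∀ {π} (f : Q → _) → Bijective _≡_ _≡_ f →
               (∀ x → S π x ⇔ Q₁ (f x)) → Σ Q (S π)
    preimage f (_ , surj) lines with surj q
    ... | x , fx≡q = x , Equivalence.from (lines x) (subst Q₁ (sym (fx≡q refl)) q∈Q₁)

  module WithQuasigroup (qg : IsQuasigroup Q _·_) where
    open IsQuasigroup qg

    _\\_ : Q → Q → Q
    a \\ b = proj₁ (leftSolve a b)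

    \\-spec : ∀ a b → a · (a \\ b) ≡ b
    \\-spec a b = proj₁ (proj₂ (leftSolve a b))

    \\-unique : ∀ {a b x} → a · x ≡ b → a \\ b ≡ x
    \\-unique {a} {b} e = proj₂ (proj₂ (leftSolve a b)) e

    _//_ : Q → Q → Q
    b // a = proj₁ (rightSolve a b)

    //-spec : ∀ a b → (b // a) · a ≡ b
    //-spec a b = proj₁ (proj₂ (rightSolve a b))

    //-unique : ∀ {a b y} → y · a ≡ b → b // a ≡ y
    //-unique {a} {b} e = proj₂ (proj₂ (rightSolve a b)) e

    \\-cancel : ∀ a x → a \\ (a · x) ≡ x
    \\-cancel a x = \\-unique refl

    //-cancel : ∀ a x → (x · a) // a ≡ x
    //-cancel a x = //-unique refl

    lcancel : ∀ {a x y} → a · x ≡ a · y → x ≡ y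
    lcancel {a} {x} e = trans (sym (\\-cancel a x)) (\\-unique (sym e))

    rcancel : ∀ {a x y} → x · a ≡ y · a → x ≡ y
    rcancel {a} {x} e = trans (sym (//-cancel a x)) (//-unique (sym e))

    LinesMeet : Pencil → Pencil → Q → Q → Set
    LinesMeet π π' g g' = Σ (Point _·_) λ p → (On _·_ p π g × On _·_ p π' g') ×
      (∀ p' → On _·_ p' π g → On _·_ p' π' g' → p ≡ p')

    linesMeet-swap : ∀ π π' {g g'} → LinesMeet π π' g g' → LinesMeet π' π g' g
    linesMeet-swap _ _ (p , (o , o') , unique) = p , (o' , o) , λ p' o₁ o₂ → unique p' o₂ o₁

    linesMeet : ∀ π π' → π ≢ π' → ∀ g g' → LinesMeet π π' g g'
    linesMeet p12 p23 _ g h = pt g h , (refl , refl) ,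
      λ p' o₁ o₂ → cong₂ pt (sym o₁) (sym o₂)
    linesMeet p12 p13 _ g k = pt g (g \\ k) , (refl , \\-spec g k) ,
      λ p' o₁ o₃ → cong₂ pt (sym o₁) (\\-unique (trans (cong (_· ptn p') (sym o₁)) o₃))
    linesMeet p23 p13 _ h k = pt (k // h) h , (refl , //-spec h k) ,
      λ p' o₂ o₃ → cong₂ pt (//-unique (trans (cong (ptg p' ·_) (sym o₂)) o₃)) (sym o₂)
    linesMeet p23 p12 _ h g = linesMeet-swap p12 p23 (linesMeet p12 p23 (λ ()) g h)
    linesMeet p13 p12 _ k g = linesMeet-swap p12 p13 (linesMeet p12 p13 (λ ()) g k)
    linesMeet p13 p23 _ k h = linesMeet-swap p23 p13 (linesMeet p23 p13 (λ ()) h k)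
    linesMeet p12 p12 π≢π _ _ = ⊥-elim (π≢π refl)
    linesMeet p23 p23 π≢π _ _ = ⊥-elim (π≢π refl)
    linesMeet p13 p13 π≢π _ _ = ⊥-elim (π≢π refl)

    -- Two lines of a triangle in S suffice for the third, so a point with
    -- two of its lines in a triangle-closed S is a triangle point of S.
    closed⇒trianglePoint : ∀ {S} → TriangleClosed S → ∀ π π' → π ≢ π' →
      ∀ {p g g'} → On _·_ p π g → On _·_ p π' g' → S π g → S π' g' →
      TrianglePoints _·_ S p
    closed⇒trianglePoint C p12 p23 _ refl refl s₁ s₂ = s₁ , s₂ , close13 s₁ s₂
      where open TriangleClosed C
    closed⇒trianglePoint C p23 p12 _ refl refl s₂ s₁ = s₁ , s₂ , close13 s₁ s₂
      where open TriangleClosed C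
    closed⇒trianglePoint C p12 p13 _ refl refl s₁ s₃ = s₁ , close23 s₁ s₃ refl , s₃
      where open TriangleClosed C
    closed⇒trianglePoint C p13 p12 _ refl refl s₃ s₁ = s₁ , close23 s₁ s₃ refl , s₃
      where open TriangleClosed C
    closed⇒trianglePoint C p23 p13 _ refl refl s₂ s₃ = close12 s₂ s₃ refl , s₂ , s₃
      where open TriangleClosed C
    closed⇒trianglePoint C p13 p23 _ refl refl s₃ s₂ = close12 s₂ s₃ refl , s₂ , s₃
      where open TriangleClosed C
    closed⇒trianglePoint C p12 p12 π≢π _ _ _ _ = ⊥-elim (π≢π refl)
    closed⇒trianglePoint C p23 p23 π≢π _ _ _ _ = ⊥-elim (π≢π refl)
    closed⇒trianglePoint C p13 p13 π≢π _ _ _ _ = ⊥-elim (π≢π refl)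

    -- Biased expansions of K₃ inside ⟨Q K₃⟩ are exactly the spanning,
    -- triangle-closed line sets meeting every pencil: uniqueness of the
    -- completing edge is automatic, since divisions in Q are unique.
    biasedExpansion⇒closed : ∀ {V S} → IsBiasedExpansion _·_ V S → TriangleClosed S
    biasedExpansion⇒closed {S = S} be = record
      { close12 = close12 ; close23 = close23 ; close13 = close13 }
      where
      open IsBiasedExpansion be
      close12 : ∀ {g h k} → S p23 h → S p13 k → g · h ≡ k → S p12 g
      close12 {g} {h} {k} sh sk e with over12 h k sh sk
      ... | g' , (sg' , e') , _ = subst (S p12) (rcancel (trans e' (sym e))) sg'
      close23 : ∀ {g h k} → S p12 g → S p13 k → g · h ≡ k → S p23 h
      close23 {g} {h} {k} sg sk e with over23 g k sg sk
      ... | h' , (sh' , e') , _ = subst (S p23) (lcancel (trans e' (sym e))) sh'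
      close13 : ∀ {g h} → S p12 g → S p23 h → S p13 (g · h)
      close13 {g} {h} sg sh with over13 g h sg sh
      ... | k , (sk , e) , _ = subst (S p13) (sym e) sk

    closed⇒biasedExpansion : ∀ {V S} → Spanning _·_ V → TriangleClosed S →
      Inhabited S → IsBiasedExpansion _·_ V S
    closed⇒biasedExpansion spanning C inh = record
      { allNodes = spanning
      ; surj = inh
      ; over12 = λ h k sh sk → k // h , (close12 sh sk (//-spec h k) , //-spec h k) ,
          λ { (_ , e) → //-unique e }
      ; over23 = λ g k sg sk → g \\ k , (close23 sg sk (\\-spec g k) , \\-spec g k) ,
          λ { (_ , e) → \\-unique e }
      ; over13 = λ g h sg sh → g · h , (close13 sg sh , refl) , λ { (_ , e) → e } }
      where open TriangleClosed C

    inhabited-12-23 : ∀ {S} → TriangleClosed S → Σ Q (S p12) → Σ Q (S p23) → Inhabited S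
    inhabited-12-23 C (g , sg) (h , sh) p12 = g , sg
    inhabited-12-23 C (g , sg) (h , sh) p23 = h , sh
    inhabited-12-23 C (g , sg) (h , sh) p13 = g · h , TriangleClosed.close13 C sg sh

    inhabited-12-13 : ∀ {S} → TriangleClosed S → Σ Q (S p12) → Σ Q (S p13) → Inhabited S
    inhabited-12-13 C (g , sg) (k , sk) =
      inhabited-12-23 C (g , sg) (g \\ k , TriangleClosed.close23 C sg sk (\\-spec g k))

    inhabited-23-13 : ∀ {S} → TriangleClosed S → Σ Q (S p23) → Σ Q (S p13) → Inhabited S
    inhabited-23-13 C (h , sh) (k , sk) =
      inhabited-12-23 C (k // h , TriangleClosed.close12 C sh sk (//-spec h k)) (h , sh)

    -- Edges at all three nodes involve at least two pencils.
    edgesAtAllNodes⇒inhabited : ∀ {S} → TriangleClosed S →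
      EdgeAt S v1 → EdgeAt S v2 → EdgeAt S v3 → Inhabited S
    edgesAtAllNodes⇒inhabited C (inj₁ a) (inj₂ b) _ = inhabited-12-23 C a b
    edgesAtAllNodes⇒inhabited C (inj₁ a) (inj₁ _) (inj₁ b) = inhabited-12-23 C a b
    edgesAtAllNodes⇒inhabited C (inj₁ a) (inj₁ _) (inj₂ c) = inhabited-12-13 C a c
    edgesAtAllNodes⇒inhabited C (inj₂ c) (inj₁ a) _ = inhabited-12-13 C a c
    edgesAtAllNodes⇒inhabited C (inj₂ c) (inj₂ b) _ = inhabited-23-13 C b c

    connected⇒inhabited : ∀ {V S} → Spanning _·_ V → TriangleClosed S →
      Connected _·_ V S → Inhabited S
    connected⇒inhabited spanning C conn = edgesAtAllNodes⇒inhabited C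
      (reach⇒edgeAt (λ ()) (walk v2 v1))
      (reach⇒edgeAt (λ ()) (walk v1 v2))
      (reach⇒edgeAt (λ ()) (walk v1 v3))
      where
      walk : ∀ u w → Reach _·_ _ u w
      walk u w = conn u w (spanning u) (spanning w)

    subnetPoint⇒trianglePoint : ∀ {P S} → IsSubnet _·_ P S → ∀ {p} → P p →
      TrianglePoints _·_ S p
    subnetPoint⇒trianglePoint {S = S} sn {p} p∈P
      with eachPoint p p∈P p12 | eachPoint p p∈P p23 | eachPoint p p∈P p13
      where open IsSubnet sn
    ... | _ , (s₁ , o₁) , _ | _ , (s₂ , o₂) , _ | _ , (s₃ , o₃) , _ =
      subst (S p12) (sym o₁) s₁ , subst (S p23) (sym o₂) s₂ , subst (S p13) (sym o₃) s₃

    -- The line set of a 3-subnet is triangle-closed: two of the lines meet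
    -- in a point of the subnet, and the third line through it is in S.
    subnet⇒closed : ∀ {P S} → IsSubnet _·_ P S → TriangleClosed S
    subnet⇒closed {S = S} sn = record
      { close12 = close12 ; close23 = close23 ; close13 = close13 }
      where
      open IsSubnet sn
      triangle = subnetPoint⇒trianglePoint sn
      close12 : ∀ {g h k} → S p23 h → S p13 k → g · h ≡ k → S p12 g
      close12 {g} {h} {k} sh sk e with diffPencil p23 p13 (λ ()) h k sh sk
      ... | p , (p∈P , refl , refl) , _ = subst (S p12) (rcancel (sym e)) (proj₁ (triangle p∈P))
      close23 : ∀ {g h k} → S p12 g → S p13 k → g · h ≡ k → S p23 h
      close23 {g} {h} {k} sg sk e with diffPencil p12 p13 (λ ()) g k sg sk
      ... | p , (p∈P , refl , refl) , _ = subst (S p23) (lcancel (sym e)) (proj₁ (proj₂ (triangle p∈P)))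
      close13 : ∀ {g h} → S p12 g → S p23 h → S p13 (g · h)
      close13 {g} {h} sg sh with diffPencil p12 p23 (λ ()) g h sg sh
      ... | p , (p∈P , refl , refl) , _ = proj₂ (proj₂ (triangle p∈P))

    -- A 3-subnet has a point, hence a line in every pencil.
    subnet⇒inhabited : ∀ {P S} → IsSubnet _·_ P S → Inhabited S
    subnet⇒inhabited sn with IsSubnet.nonempty sn
    ... | p , p∈P with subnetPoint⇒trianglePoint sn p∈P
    ... | s₁ , s₂ , s₃ = λ { p12 → _ , s₁ ; p23 → _ , s₂ ; p13 → _ , s₃ }

    subnetPoints : ∀ {P S} → IsSubnet _·_ P S → ∀ p →
      P p ⇔ (S p12 (ptg p) × S p23 (ptn p))
    subnetPoints {P} {S} sn p = mk⇔ to from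
      where
      to : P p → S p12 (ptg p) × S p23 (ptn p)
      to p∈P with subnetPoint⇒trianglePoint sn p∈P
      ... | s₁ , s₂ , _ = s₁ , s₂
      from : S p12 (ptg p) × S p23 (ptn p) → P p
      from (s₁ , s₂) with IsSubnet.diffPencil sn p12 p23 (λ ()) _ _ s₁ s₂
      ... | p' , (p'∈P , o₁ , o₂) , _ = subst P (cong₂ pt o₁ o₂) p'∈P

    closed⇒subnet : ∀ {S} → TriangleClosed S → Inhabited S →
      IsSubnet _·_ (TrianglePoints _·_ S) S
    closed⇒subnet {S} C inh = record
      { nonempty = pt a b , s₁ , s₂ , TriangleClosed.close13 C s₁ s₂
      ; samePencil = λ π g g' _ _ g≢g' p _ o o' → g≢g' (on-functional π o o')
      ; diffPencil = diffPencil
      ; eachPoint = eachPoint }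
      where
      a = proj₁ (inh p12)
      s₁ = proj₂ (inh p12)
      b = proj₁ (inh p23)
      s₂ = proj₂ (inh p23)
      diffPencil : ∀ π π' → π ≢ π' → ∀ g g' → S π g → S π' g' →
        Σ (Point _·_) λ p → (TrianglePoints _·_ S p × On _·_ p π g × On _·_ p π' g') ×
          (∀ p' → TrianglePoints _·_ S p' → On _·_ p' π g → On _·_ p' π' g' → p ≡ p')
      diffPencil π π' π≢π' g g' s s' with linesMeet π π' π≢π' g g'
      ... | p , (o , o') , unique =
        p , (closed⇒trianglePoint C π π' π≢π' o o' s s' , o , o') , λ p' _ → unique p'
      eachPoint : ∀ p → TrianglePoints _·_ S p → ∀ π → Σ Q λ g → (S π g × On _·_ p π g) ×
        (∀ g' → S π g' → On _·_ p π g' → g ≡ g')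
      eachPoint p (t₁ , t₂ , t₃) p12 = _ , (t₁ , refl) , λ _ _ o → o
      eachPoint p (t₁ , t₂ , t₃) p23 = _ , (t₂ , refl) , λ _ _ o → o
      eachPoint p (t₁ , t₂ , t₃) p13 = _ , (t₃ , refl) , λ _ _ o → o

    isotopeIsQuasigroup : (α αⁱ β βⁱ : Q → Q) →
      (∀ y → α (αⁱ y) ≡ y) → (∀ x → αⁱ (α x) ≡ x) →
      (∀ y → β (βⁱ y) ≡ y) → (∀ x → βⁱ (β x) ≡ x) →
      IsQuasigroup Q (λ x y → αⁱ x · βⁱ y)
    isotopeIsQuasigroup α αⁱ β βⁱ ααⁱ αⁱα ββⁱ βⁱβ = record
      { leftSolve = λ u v → β (αⁱ u \\ v) ,
          trans (cong (αⁱ u ·_) (βⁱβ _)) (\\-spec (αⁱ u) v) ,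
          λ {y} e → trans (cong β (\\-unique e)) (ββⁱ y)
      ; rightSolve = λ u v → α (v // βⁱ u) ,
          trans (cong (_· βⁱ u) (αⁱα _)) (//-spec (βⁱ u) v) ,
          λ {y} e → trans (cong α (//-unique e)) (ααⁱ y) }

    -- A triangle-closed S meeting every pencil is ⟨Q₁ K₃⟩ for Q₁ = S₁₃ as
    -- a subquasigroup of the principal isotope x ⊗ y = (x // b) · (a \\ y),
    -- where a ∈ S₁₂, b ∈ S₂₃; the isotopy is (x ↦ x · b , y ↦ a · y , id).
    closed⇒isotopeSub : ∀ {S} → TriangleClosed S → Inhabited S → IsotopeSub _·_ Q S
    closed⇒isotopeSub {S} C inh = record
      { _⊗_ = λ x y → (x // b) · (a \\ y)
      ; isQuasigroup = isotopeIsQuasigroup (_· b) (_// b) (a ·_) (a \\_)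
          (//-spec b) (//-cancel b) (\\-spec a) (\\-cancel a)
      ; α = _· b
      ; β = a ·_
      ; γ = λ k → k
      ; isotopy = record
        { α-bij = inverse⇒bijective (_· b) (_// b) (//-spec b) (//-cancel b)
        ; β-bij = inverse⇒bijective (a ·_) (a \\_) (\\-spec a) (\\-cancel a)
        ; γ-bij = inverse⇒bijective (λ k → k) (λ k → k) (λ _ → refl) (λ _ → refl)
        ; iso = λ x y → cong₂ _·_ (//-cancel b x) (\\-cancel a y) }
      ; Q₁ = S p13
      ; sub = record
        { nonempty = a · b , close13 sa sb
        ; mulClosed = λ x y sx sy → close13 (lift12 sx) (lift23 sy)
        ; ldivClosed = λ u v x su sv e →
            subst (S p13) (\\-spec a x) (close13 sa (close23 (lift12 su) sv e))
        ; rdivClosed = λ u v y su sv e →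
            subst (S p13) (//-spec b y) (close13 (close12 (lift23 su) sv e) sb) }
      ; lines12 = λ g → mk⇔ (λ s → close13 s sb) (λ t → close12 sb t refl)
      ; lines23 = λ h → mk⇔ (λ s → close13 sa s) (λ t → close23 sa t refl)
      ; lines13 = λ k → mk⇔ (λ s → s) (λ s → s) }
      where
      open TriangleClosed C
      a = proj₁ (inh p12)
      sa = proj₂ (inh p12)
      b = proj₁ (inh p23)
      sb = proj₂ (inh p23)
      lift12 : ∀ {x} → S p13 x → S p12 (x // b)
      lift12 {x} sx = close12 sb sx (//-spec b x)
      lift23 : ∀ {y} → S p13 y → S p23 (a \\ y)
      lift23 {y} sy = close23 sa sy (\\-spec a y)

    subnet⇒netForm : ∀ P S → IsSubnet _·_ P S → NetForm _·_ P S
    subnet⇒netForm P S sn = Q , I , λ p →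
      mk⇔ (λ p∈P → let (s₁ , s₂) = to (subnetPoints sn p) p∈P in
                     to (lines12 _) s₁ , to (lines23 _) s₂)
          (λ (q₁ , q₂) → from (subnetPoints sn p) (from (lines12 _) q₁ , from (lines23 _) q₂))
      where
      I = closed⇒isotopeSub (subnet⇒closed sn) (subnet⇒inhabited sn)
      open IsotopeSub I
      open Equivalence

    biasedExpansion⇔balanceClosedConnected : ∀ V S → IsBiasedExpansion _·_ V S ⇔
      (BalanceClosed _·_ S × Spanning _·_ V × Connected _·_ V S)
    biasedExpansion⇔balanceClosedConnected V S = mk⇔
      (λ be → from (balanceClosed⇔triangleClosed S) (biasedExpansion⇒closed be) ,
              IsBiasedExpansion.allNodes be ,
              λ u w _ _ → inhabited⇒connected (IsBiasedExpansion.surj be) u w)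
      (λ (bc , spanning , conn) → let C = to (balanceClosed⇔triangleClosed S) bc in
         closed⇒biasedExpansion spanning C (connected⇒inhabited spanning C conn))
      where open Equivalence

    biasedExpansion⇔quasigroupExpansion : ∀ V S → IsBiasedExpansion _·_ V S ⇔
      (Spanning _·_ V × QuasigroupExpansionForm _·_ S)
    biasedExpansion⇔quasigroupExpansion V S = mk⇔
      (λ be → IsBiasedExpansion.allNodes be , Q ,
              closed⇒isotopeSub (biasedExpansion⇒closed be) (IsBiasedExpansion.surj be))
      (λ (spanning , (_ , I)) →
         closed⇒biasedExpansion spanning (isotopeSub⇒closed I) (isotopeSub⇒inhabited I))

open WithQuasigroup

proposition2p6 : (Q : Set) (_·_ : Q → Q → Q) → IsQuasigroup Q _·_ →
    (∀ P S → IsSubnet _·_ P S → NetForm _·_ P S) ×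
    (∀ P S → IsSubnet _·_ P S → IsBiasedExpansion _·_ (λ _ → Data.Unit.⊤) S) ×
    (∀ V S → IsSubgraph _·_ V S → IsBiasedExpansion _·_ V S →
       IsSubnet _·_ (TrianglePoints _·_ S) S) ×
    (∀ V S → IsSubgraph _·_ V S →
       IsBiasedExpansion _·_ V S ⇔
         (BalanceClosed _·_ S × Spanning _·_ V × Connected _·_ V S)) ×
    (∀ V S → IsSubgraph _·_ V S →
       IsBiasedExpansion _·_ V S ⇔
         (Spanning _·_ V × QuasigroupExpansionForm _·_ S))
proposition2p6 Q _·_ qg =
  subnet⇒netForm _·_ qg ,
  (λ P S sn → closed⇒biasedExpansion _·_ qg (λ _ → tt)
                (subnet⇒closed _·_ qg sn) (subnet⇒inhabited _·_ qg sn)) ,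
  (λ V S _ be → closed⇒subnet _·_ qg
                  (biasedExpansion⇒closed _·_ qg be) (IsBiasedExpansion.surj be)) ,
  (λ V S _ → biasedExpansion⇔balanceClosedConnected _·_ qg V S) ,
  (λ V S _ → biasedExpansion⇔quasigroupExpansion _·_ qg V S)
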